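{- Let $\pi\in S_n$ be a permutation all of whose cycles have odd length, and write $\pi=\mathfrak c_1\cdots\mathfrak c_k$ as a product of its $k$ disjoint cycles (including fixed points as cycles of length 1). Then \[ M(\pi)\le\frac{n-k}{2}, \] with equality if and only if $M(\mathfrak c_i)=\frac{|\mathfrak c_i|-1}{2}$ for all $i$.
   Context: For a cycle $\mathfrak c=(c_1,\dots,c_m)$ of length $|\mathfrak c|=m$, let $\mathrm{cA}(\mathfrak c)$ be the number of $i\in\{1,\dots,m\}$ with $c_i\le c_{i+1}$ and $\mathrm{cD}(\mathfrak c)$ the number with $c_i>c_{i+1}$, where $c_{m+1}=c_1$; let $M(\mathfrak c)=\min(\mathrm{cA}(\mathfrak c),\mathrm{cD}(\mathfrak c))$, and for a permutation $\pi$ let $M(\pi)$ be the sum of $M$ over its cycles. -}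

module Defs where

open import Data.Nat using (ℕ; suc; _+_; _*_; _⊓_)
open import Data.Fin using (Fin; _≤?_; _<?_)
open import Data.Fin.Permutation using (Permutation′; _⟨$⟩ʳ_)
open import Data.List using (List; []; _∷_; _∷ʳ_; length; filter; zip; map; concat; allFin)
open import Data.Nat.ListAction using (sum)
open import Data.Empty using (⊥)
open import Data.List.Relation.Unary.All using (All)
open import Data.List.Relation.Binary.Permutation.Propositional using (_↭_)
open import Data.Product using (_×_; _,_; ∃; proj₁; proj₂)
open import Relation.Binary.PropositionalEquality using (_≡_)

-- A cycle 𝔠 = (c₁,…,c_m) is written as the list c₁ ∷ … ∷ c_m ∷ [].
-- rot 𝔠 = (c₂,…,c_m,c₁), so zip 𝔠 (rot 𝔠) lists the pairs (c_i , c_{i+1}) with c_{m+1} = c₁.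
rot : ∀ {n} → List (Fin n) → List (Fin n)
rot []       = []
rot (x ∷ xs) = xs ∷ʳ x

cA : ∀ {n} → List (Fin n) → ℕ
cA c = length (filter (λ p → proj₁ p ≤? proj₂ p) (zip c (rot c)))

cD : ∀ {n} → List (Fin n) → ℕ
cD c = length (filter (λ p → proj₂ p <? proj₁ p) (zip c (rot c)))

Mc : ∀ {n} → List (Fin n) → ℕ
Mc c = cA c ⊓ cD c

Mπ : ∀ {n} → List (List (Fin n)) → ℕ
Mπ cs = sum (map Mc cs)

IsCycleOf : ∀ {n} → Permutation′ n → List (Fin n) → Set
IsCycleOf π []       = ⊥
IsCycleOf π (x ∷ xs) = map (π ⟨$⟩ʳ_) (x ∷ xs) ≡ (xs ∷ʳ x)

-- cs is the decomposition of π into disjoint cycles (fixed points included as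
-- cycles of length 1): every element of Fin n occurs exactly once among the
-- cycles, and each listed cycle is a cycle of π.
IsCycleDecomposition : ∀ {n} → Permutation′ n → List (List (Fin n)) → Set
IsCycleDecomposition {n} π cs = (concat cs ↭ allFin n) × All (IsCycleOf π) cs

OddLength : ∀ {n} → List (Fin n) → Set
OddLength c = ∃ λ t → length c ≡ suc (2 * t)

-- Each of the m cyclic steps of a cycle 𝔠 is an ascent or a descent, so 2 M(𝔠) ≤ cA + cD = m;
-- for odd m the even number 2 M(𝔠) is then at most m − 1. The lengths of the k cycles add up
-- to n, so summing gives 2 M(π) ≤ n − k, and a sum of termwise inequalities is an equality
-- exactly when every term is.
module Submission where

open import Defs
open import Data.Nat using (ℕ; suc; _+_; _*_; _∸_; _⊓_; _≤_; _<_; z≤n; s≤s)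
open import Data.Nat.Properties hiding (_≤?_; _<?_)
open import Data.Nat.ListAction using (sum)
open import Data.List using (List; []; _∷_; length; map; concat; filter; zip; allFin)
open import Data.List.Properties using (length-++; length-zipWith; length-tabulate; filter-accept; filter-reject)
open import Data.List.Relation.Unary.All as All using (All; []; _∷_)
open import Data.List.Relation.Binary.Permutation.Propositional.Properties using (↭-length)
open import Data.Fin using (Fin; _≤?_; _<?_)
open import Data.Fin.Permutation using (Permutation′)
open import Data.Product using (_×_; _,_; proj₁; proj₂)
open import Data.Sum using (inj₁; inj₂)
open import Function.Bundles using (_⇔_; mk⇔)
open import Relation.Nullary using (yes; no; contradiction)
open import Relation.Binary.PropositionalEquality
open ≡-Reasoning
open import Algebra.Properties.CommutativeSemigroup +-commutativeSemigroup using (x∙yz≈y∙xz)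

module _ {n : ℕ} where

  length-filter-≤?+length-filter->? : (ps : List (Fin n × Fin n)) →
    length (filter (λ p → proj₁ p ≤? proj₂ p) ps) + length (filter (λ p → proj₂ p <? proj₁ p) ps)
      ≡ length ps
  length-filter-≤?+length-filter->? [] = refl
  length-filter-≤?+length-filter->? ((a , b) ∷ ps) with a ≤? b | b <? a
  ... | yes a≤b | yes b<a = contradiction a≤b (<⇒≱ b<a)
  ... | yes a≤b | no b≮a
    rewrite filter-accept (λ p → proj₁ p ≤? proj₂ p) {a , b} {ps} a≤b
          | filter-reject (λ p → proj₂ p <? proj₁ p) {a , b} {ps} b≮a
    = cong suc (length-filter-≤?+length-filter->? ps)
  ... | no a≰b  | yes b<a
    rewrite filter-reject (λ p → proj₁ p ≤? proj₂ p) {a , b} {ps} a≰b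
          | filter-accept (λ p → proj₂ p <? proj₁ p) {a , b} {ps} b<a
    = trans (+-suc _ _) (cong suc (length-filter-≤?+length-filter->? ps))
  ... | no a≰b  | no b≮a  = contradiction (≰⇒> a≰b) b≮a

  length-rot : (c : List (Fin n)) → length (rot c) ≡ length c
  length-rot []       = refl
  length-rot (x ∷ xs) = trans (length-++ xs) (+-comm (length xs) 1)

  cA+cD≡length : (c : List (Fin n)) → cA c + cD c ≡ length c
  cA+cD≡length c = begin
    cA c + cD c                    ≡⟨ length-filter-≤?+length-filter->? (zip c (rot c)) ⟩
    length (zip c (rot c))         ≡⟨ length-zipWith _,_ c (rot c) ⟩
    length c ⊓ length (rot c)      ≡⟨ cong (length c ⊓_) (length-rot c) ⟩
    length c ⊓ length c            ≡⟨ ⊓-idem (length c) ⟩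
    length c                       ∎

2*[m⊓n]≤m+n : ∀ m n → 2 * (m ⊓ n) ≤ m + n
2*[m⊓n]≤m+n m n = subst (_≤ m + n) (cong (m ⊓ n +_) (sym (+-identityʳ (m ⊓ n))))
  (+-mono-≤ (m⊓n≤m m n) (m⊓n≤n m n))

2*m≤1+2*n⇒2*m≤2*n : ∀ m n → 2 * m ≤ suc (2 * n) → 2 * m ≤ 2 * n
2*m≤1+2*n⇒2*m≤2*n m n 2m≤1+2n = *-monoʳ-≤ 2 (<⇒≤pred (*-cancelˡ-< 2 m (suc n) 2m<2[1+n]))
  where
  2m<2[1+n] : 2 * m < 2 * suc n
  2m<2[1+n] = subst (2 * m <_) (sym (*-suc 2 n)) (s≤s 2m≤1+2n)

2*Mc≤length∸1 : ∀ {n} (c : List (Fin n)) → OddLength c → 2 * Mc c ≤ length c ∸ 1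
2*Mc≤length∸1 c (t , |c|≡1+2t) rewrite |c|≡1+2t =
  2*m≤1+2*n⇒2*m≤2*n (Mc c) t
    (subst (2 * Mc c ≤_) (trans (cA+cD≡length c) |c|≡1+2t) (2*[m⊓n]≤m+n (cA c) (cD c)))

module _ {A : Set} where

  *-distribˡ-sum-map : ∀ k (f : A → ℕ) xs → k * sum (map f xs) ≡ sum (map (λ x → k * f x) xs)
  *-distribˡ-sum-map k f []       = *-zeroʳ k
  *-distribˡ-sum-map k f (x ∷ xs) =
    trans (*-distribˡ-+ k (f x) _) (cong (k * f x +_) (*-distribˡ-sum-map k f xs))

  module _ (f g : A → ℕ) where

    sum-map-mono-≤ : ∀ {xs} → All (λ x → f x ≤ g x) xs → sum (map f xs) ≤ sum (map g xs)
    sum-map-mono-≤ []           = z≤n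
    sum-map-mono-≤ (fx≤gx ∷ ps) = +-mono-≤ fx≤gx (sum-map-mono-≤ ps)

    sum-map-≡⇔All-≡ : ∀ {xs} → All (λ x → f x ≤ g x) xs →
      (sum (map f xs) ≡ sum (map g xs)) ⇔ All (λ x → f x ≡ g x) xs
    sum-map-≡⇔All-≡ ps = mk⇔ (tight ps) cong-sum
      where
      tight : ∀ {xs} → All (λ x → f x ≤ g x) xs → sum (map f xs) ≡ sum (map g xs) →
        All (λ x → f x ≡ g x) xs
      tight [] _ = []
      tight {x ∷ _} (fx≤gx ∷ ps) eq with m≤n⇒m<n∨m≡n fx≤gx
      ... | inj₁ fx<gx = contradiction eq (<⇒≢ (+-mono-<-≤ fx<gx (sum-map-mono-≤ ps)))
      ... | inj₂ fx≡gx = fx≡gx ∷ tight ps (+-cancelˡ-≡ (f x) _ _ (trans eq (cong (_+ _) (sym fx≡gx))))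

      cong-sum : ∀ {xs} → All (λ x → f x ≡ g x) xs → sum (map f xs) ≡ sum (map g xs)
      cong-sum []         = refl
      cong-sum (eq ∷ eqs) = cong₂ _+_ eq (cong-sum eqs)

  sum-map-pred : (f : A → ℕ) {xs : List A} → All (λ x → 1 ≤ f x) xs →
    sum (map f xs) ≡ length xs + sum (map (λ x → f x ∸ 1) xs)
  sum-map-pred f []                   = refl
  sum-map-pred f {x ∷ xs} (1≤fx ∷ ps) = begin
    f x + sum (map f xs)                  ≡⟨ cong₂ _+_ (sym (m+[n∸m]≡n 1≤fx)) (sum-map-pred f ps) ⟩
    suc (f x ∸ 1 + (length xs + rest))    ≡⟨ cong suc (x∙yz≈y∙xz (f x ∸ 1) (length xs) rest) ⟩
    suc (length xs + (f x ∸ 1 + rest))    ∎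
    where
    rest = sum (map (λ x → f x ∸ 1) xs)

length-concat : ∀ {A : Set} (xss : List (List A)) → length (concat xss) ≡ sum (map length xss)
length-concat []         = refl
length-concat (xs ∷ xss) = trans (length-++ xs) (cong (length xs +_) (length-concat xss))

module _ {n : ℕ} {π : Permutation′ n} where

  cycle-nonempty : ∀ {c} → IsCycleOf π c → 1 ≤ length c
  cycle-nonempty {_ ∷ _} _ = s≤s z≤n

  n∸#cycles≡sum-length∸1 : ∀ {cs} → IsCycleDecomposition π cs →
    n ∸ length cs ≡ sum (map (λ c → length c ∸ 1) cs)
  n∸#cycles≡sum-length∸1 {cs} (concat↭allFin , cycles) =
    trans (cong (_∸ length cs) n≡) (m+n∸m≡n (length cs) _)
    where
    n≡ : n ≡ length cs + sum (map (λ c → length c ∸ 1) cs)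
    n≡ = begin
      n                    ≡⟨ length-tabulate (λ i → i) ⟨
      length (allFin n)    ≡⟨ ↭-length concat↭allFin ⟨
      length (concat cs)   ≡⟨ length-concat cs ⟩
      sum (map length cs)  ≡⟨ sum-map-pred length (All.map cycle-nonempty cycles) ⟩
      length cs + sum (map (λ c → length c ∸ 1) cs) ∎

lemma5p1 : (n : ℕ) (π : Permutation′ n) (cs : List (List (Fin n))) →
    IsCycleDecomposition π cs → All OddLength cs →
    (2 * Mπ cs ≤ n ∸ length cs) ×
    ((2 * Mπ cs ≡ n ∸ length cs) ⇔ All (λ c → 2 * Mc c ≡ length c ∸ 1) cs)
lemma5p1 n π cs decomposition odd =
  subst₂ _≤_ (sym 2M≡) (sym n∸k≡) (sum-map-mono-≤ f g bounds) ,
  subst₂ (λ l r → (l ≡ r) ⇔ All (λ c → f c ≡ g c) cs) (sym 2M≡) (sym n∸k≡) (sum-map-≡⇔All-≡ f g bounds)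
  where
  f g : List (Fin n) → ℕ
  f c = 2 * Mc c
  g c = length c ∸ 1
  bounds : All (λ c → f c ≤ g c) cs
  bounds = All.map (λ {c} → 2*Mc≤length∸1 c) odd
  2M≡ : 2 * Mπ cs ≡ sum (map f cs)
  2M≡ = *-distribˡ-sum-map 2 Mc cs
  n∸k≡ : n ∸ length cs ≡ sum (map g cs)
  n∸k≡ = n∸#cycles≡sum-length∸1 decomposition
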